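{- Let $G$ be a graph without isolated vertices, $B$ a $\wedge_d$-OBDD representing $\psi(G)$ and obeying a linear order $\pi^*$ of $V(G^*)$. Let $U=\{u_1,\dots,u_q\}$, $W=\{w_1,\dots,w_q\}\subseteq V(G)$ be such that $M=\{\{u_i[1],w_i[2]\}:1\le i\le q\}$ is an induced matching of $G^*$ and every element of $U[1]$ precedes every element of $W[2]$ in $\pi^*$. Let $\pi_0$ be the prefix of $\pi^*$ ending with the last element of $U[1]$ and let $\mathcal{F}$, $I({\bf g})$ be as defined in the context. Then for every ${\bf g}\in\mathcal{F}$, the set $\mathcal{S}(B)|_{\bf g}$ does not break $W[2]_{I({\bf g})}$.
   Context: $G^*$ has vertex set $V[1]\cup V[2]$ ($V[i]=\{v[i]:v\in V(G)\}$ disjoint copies of $V(G)$) and edges $\{u[1],v[2]\}$, $\{v[1],u[2]\}$ for each $\{u,v\}\in E(G)$; $U[i]=\{u[i]:u\in U\}$. $\psi(G)$ is the CNF on $V(G^*)$ with clause $(a\vee b)$ per edge $\{a,b\}$ of $G^*$ plus clauses $\bigvee_{v}\neg v[1]$ and $\bigvee_v\neg v[2]$. A matching is induced if there is no edge between endpoints of distinct matching edges. Assignments are maps from variable sets to $\{0,1\}$, viewed as sets of pairs; a set of assignments is uniform if all have the same domain; $\mathcal{H}_1\times\mathcal{H}_2=\{{\bf a}\cup{\bf b}\}$ for disjoint domains. A $\wedge_d$-FBDD is a DAG with one source, sinks ${\bf 0},{\bf 1}$, decision nodes labelled by variables with out-edges labelled $0,1$ and conjunction nodes with two children, such that the variable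 sets below the two children of each conjunction node are disjoint and no path repeats a variable. Accepted assignments: $\{\emptyset\}$ at ${\bf 1}$, $\emptyset$ at ${\bf 0}$, $\mathcal{A}(B_{u_0})\times\{(x,0)\}\cup\mathcal{A}(B_{u_1})\times\{(x,1)\}$ at a decision node labelled $x$, $\mathcal{A}(B_{u_0})\times\mathcal{A}(B_{u_1})$ at a conjunction node; $\mathcal{S}(B)$ is the set of assignments to $\mathsf{var}(B)$ (the labels of decision nodes) extending an accepted one; $B$ represents $\psi(G)$ if $\mathsf{var}(B)=V(G^*)$ and $\mathcal{S}(B)$ is the set of satisfying assignments of $\psi(G)$. $B$ is a $\wedge_d$-OBDD obeying $\pi^*$ if decision labels increase in $\pi^*$ along every path. For an assignment ${\bf g}$, $\mathcal{S}(B)|_{\bf g}=\{{\bf b}\setminus{\bf g}':{\bf b}\in\mathcal{S}(B),{\bf g}'\subseteq{\bf b}\}$ where ${\bf g}'$ is ${\bf g}$ restricted to $\mathsf{var}(B)$. A uniform set $\mathcal{H}$ breaks $Y$ if there are uniform $\mathcal{H}_1,\mathcal{H}_2$ with nonempty variable sets partitioning the variable set of $\mathcal{H}$, $\mathcal{H}=\mathcal{H}_1\times\mathcal{H}_2$, and $Y$ meeting both variable sets. $\mathcal{F}$ is the set of assignments ${\bf g}$ with domain $\pi_0$ such that at least one variable of $U[1]$ is mapped to $0$, at least two variables of $U[1]$ are mapped to $1$, and all variables of $\pi_0\setminus U[1]$ are mapped to $1$. $I({\bf g})=\{i:{\bf g}(u_i[1])=1\}$ and $W[2]_J=\{w_j[2]:j\in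 J\}$. -}

module Defs where

open import Data.Nat using (ℕ; _+_)
open import Data.Fin using (Fin; _↑ˡ_; _↑ʳ_; _<_; _≤_)
open import Data.Fin.Properties using (_≟_)
open import Data.Bool using (Bool; true; false; if_then_else_)
open import Data.Maybe using (Maybe; just; nothing; maybe)
open import Data.Vec using (Vec; lookup; tabulate; zipWith)
open import Data.List using (List; []; _∷_; _++_; concatMap; concat; allFin)
open import Data.List.Membership.Propositional using (_∈_)
import Data.List.Membership.DecPropositional as DecMem
open import Data.List.Relation.Unary.All using (All)
open import Data.List.Relation.Unary.Any using (Any)
open import Data.Product using (Σ; ∃; ∃-syntax; _×_; _,_)
open import Data.Sum using (_⊎_)
open import Relation.Nullary using (¬_; does)
open import Relation.Binary.PropositionalEquality using (_≡_; _≢_)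
open import Function using (Injective; _⇔_)

record Graph (n : ℕ) : Set where
  field
    adj    : Fin n → Fin n → Bool
    sym    : ∀ u v → adj u v ≡ adj v u
    irrefl : ∀ v → adj v v ≡ false
open Graph public

Edge : ∀ {n} → Graph n → Fin n → Fin n → Set
Edge G u v = adj G u v ≡ true

NoIsolated : ∀ {n} → Graph n → Set
NoIsolated {n} G = ∀ (v : Fin n) → ∃[ u ] Edge G v u

-- The bipartite double cover G*: vertex set V[1] ∪ V[2] = Fin (n + n)

V* : ℕ → ℕ
V* n = n + n

_[1] : ∀ {n} → Fin n → Fin (V* n)
_[1] {n} v = v ↑ˡ n

_[2] : ∀ {n} → Fin n → Fin (V* n)
_[2] {n} v = n ↑ʳ v

Adj* : ∀ {n} → Graph n → Fin (V* n) → Fin (V* n) → Set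
Adj* G x y = ∃[ u ] ∃[ v ] Edge G u v ×
  ((x ≡ u [1] × y ≡ v [2]) ⊎ (x ≡ v [2] × y ≡ u [1]))

data Lit (N : ℕ) : Set where
  pos : Fin N → Lit N
  neg : Fin N → Lit N

Clause : ℕ → Set
Clause N = List (Lit N)

CNF : ℕ → Set
CNF N = List (Clause N)

Asg : ℕ → Set
Asg N = Vec (Maybe Bool) N

InDom : ∀ {N} → Asg N → Fin N → Set
InDom a x = ∃[ b ] lookup a x ≡ just b

Total : ∀ {N} → Asg N → Set
Total a = ∀ x → InDom a x

LitTrue : ∀ {N} → Asg N → Lit N → Set
LitTrue a (pos x) = lookup a x ≡ just true
LitTrue a (neg x) = lookup a x ≡ just false

SatClause : ∀ {N} → Asg N → Clause N → Set
SatClause a c = Any (LitTrue a) c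

Satisfies : ∀ {N} → Asg N → CNF N → Set
Satisfies a φ = Total a × All (SatClause a) φ

-- ψ(G): a clause (u[1] ∨ v[2]) for every ordered pair (u,v) with {u,v} ∈ E(G)
-- (this lists exactly the clauses (a ∨ b) for the edges {a,b} of G*),
-- plus ⋁_v ¬v[1] and ⋁_v ¬v[2].
ψ : ∀ {n} → Graph n → CNF (V* n)
ψ {n} G =
  concatMap (λ u → concatMap (λ v →
      if adj G u v then ((pos (u [1]) ∷ pos (v [2]) ∷ []) ∷ []) else [])
    (allFin n)) (allFin n)
  ++ (Data.List.map (λ v → neg (v [1])) (allFin n)
     ∷ Data.List.map (λ v → neg (v [2])) (allFin n) ∷ [])

-- A diagram is given by its unfolding (a rooted tree); all notions
-- below (accepted assignments, var(B), the FBDD/OBDD conditions) are defined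
-- along paths / below nodes and are invariant under unfolding a DAG.

data BDD (N : ℕ) : Set where
  𝟘 𝟙  : BDD N
  dec  : Fin N → BDD N → BDD N → BDD N   -- label x, 0-child, 1-child
  conj : BDD N → BDD N → BDD N

vars : ∀ {N} → BDD N → List (Fin N)
vars 𝟘 = []
vars 𝟙 = []
vars (dec x b₀ b₁) = x ∷ vars b₀ ++ vars b₁
vars (conj b₁ b₂) = vars b₁ ++ vars b₂

_∈var_ : ∀ {N} → Fin N → BDD N → Set
x ∈var B = x ∈ vars B

IsFBDD : ∀ {N} → BDD N → Set
IsFBDD 𝟘 = Data.Unit.⊤ where import Data.Unit
IsFBDD 𝟙 = Data.Unit.⊤ where import Data.Unit
IsFBDD (dec x b₀ b₁) = ¬ (x ∈var b₀) × ¬ (x ∈var b₁) × IsFBDD b₀ × IsFBDD b₁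
IsFBDD (conj b₁ b₂) = (∀ y → ¬ (y ∈var b₁ × y ∈var b₂)) × IsFBDD b₁ × IsFBDD b₂

LinOrder : ℕ → Set
LinOrder N = Σ (Fin N → Fin N) Injective′
  where Injective′ : (Fin N → Fin N) → Set
        Injective′ f = Injective _≡_ _≡_ f

_<[_]_ : ∀ {N} → Fin N → LinOrder N → Fin N → Set
x <[ (p , _) ] y = p x < p y

_≤[_]_ : ∀ {N} → Fin N → LinOrder N → Fin N → Set
x ≤[ (p , _) ] y = p x ≤ p y

Obeys : ∀ {N} → BDD N → LinOrder N → Set
Obeys 𝟘 π = Data.Unit.⊤ where import Data.Unit
Obeys 𝟙 π = Data.Unit.⊤ where import Data.Unit
Obeys (dec x b₀ b₁) π =
  (∀ y → y ∈var b₀ → x <[ π ] y) × (∀ y → y ∈var b₁ → x <[ π ] y) × Obeys b₀ π × Obeys b₁ π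
Obeys (conj b₁ b₂) π = Obeys b₁ π × Obeys b₂ π

IsOBDD : ∀ {N} → BDD N → LinOrder N → Set
IsOBDD B π = IsFBDD B × Obeys B π

empty : ∀ {N} → Asg N
empty = tabulate (λ _ → nothing)

-- union of two assignments (as sets of pairs; used on disjoint domains)
_∪_ : ∀ {N} → Asg N → Asg N → Asg N
a ∪ b = zipWith (λ p q → maybe just q p) a b

single : ∀ {N} → Fin N → Bool → Asg N
single x v = tabulate (λ y → if does (y ≟ x) then just v else nothing)

_⊆ₐ_ : ∀ {N} → Asg N → Asg N → Set
a ⊆ₐ b = ∀ x v → lookup a x ≡ just v → lookup b x ≡ just v

restrict : ∀ {N} → Asg N → List (Fin N) → Asg N
restrict {N} a X = tabulate (λ x → if does (x ∈? X) then lookup a x else nothing)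
  where open DecMem (_≟_ {N}) using (_∈?_)

_∖_ : ∀ {N} → Asg N → Asg N → Asg N
b ∖ g = zipWith (λ p q → maybe (λ _ → nothing) p q) b g

𝒜 : ∀ {N} → BDD N → Asg N → Set
𝒜 𝟘 a = Data.Empty.⊥ where import Data.Empty
𝒜 𝟙 a = a ≡ empty
𝒜 (dec x b₀ b₁) a =
  (∃[ a' ] 𝒜 b₀ a' × a ≡ a' ∪ single x false) ⊎
  (∃[ a' ] 𝒜 b₁ a' × a ≡ a' ∪ single x true)
𝒜 (conj b₁ b₂) a = ∃[ a₁ ] ∃[ a₂ ] 𝒜 b₁ a₁ × 𝒜 b₂ a₂ × a ≡ a₁ ∪ a₂

𝒮 : ∀ {N} → BDD N → Asg N → Set
𝒮 B b = (∀ x → x ∈var B ⇔ InDom b x) × ∃[ a ] 𝒜 B a × a ⊆ₐ b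

-- B represents the CNF φ (whose variable set is all of Fin N)
Represents : ∀ {N} → BDD N → CNF N → Set
Represents {N} B φ = (∀ (x : Fin N) → x ∈var B) × (∀ b → 𝒮 B b ⇔ Satisfies b φ)

𝒮∣ : ∀ {N} → BDD N → Asg N → Asg N → Set
𝒮∣ B g h = ∃[ b ] 𝒮 B b × restrict g (vars B) ⊆ₐ b × h ≡ b ∖ restrict g (vars B)

dom𝒮∣ : ∀ {N} → BDD N → Asg N → Fin N → Set
dom𝒮∣ B g x = x ∈var B × ¬ InDom g x

UniformOn : ∀ {N} → (Fin N → Set) → (Asg N → Set) → Set
UniformOn D ℋ = ∀ a → ℋ a → ∀ x → D x ⇔ InDom a x

Breaks : ∀ {N} → (Fin N → Set) → (Asg N → Set) → (Fin N → Set) → Set₁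
Breaks {N} D ℋ Y =
  UniformOn D ℋ ×
  Σ (Fin N → Set) λ D₁ → Σ (Fin N → Set) λ D₂ →
  Σ (Asg N → Set) λ ℋ₁ → Σ (Asg N → Set) λ ℋ₂ →
    UniformOn D₁ ℋ₁ × UniformOn D₂ ℋ₂ ×
    (∃[ x ] D₁ x) × (∃[ x ] D₂ x) ×
    (∀ x → D x ⇔ (D₁ x ⊎ D₂ x)) × (∀ x → ¬ (D₁ x × D₂ x)) ×
    (∀ a → ℋ a ⇔ (∃[ a₁ ] ∃[ a₂ ] ℋ₁ a₁ × ℋ₂ a₂ × a ≡ a₁ ∪ a₂)) ×
    (∃[ x ] Y x × D₁ x) × (∃[ x ] Y x × D₂ x)

InducedMatching : ∀ {n q} → Graph n → (Fin q → Fin n) → (Fin q → Fin n) → Set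
InducedMatching G u w =
  (∀ i → Adj* G (u i [1]) (w i [2])) ×
  (∀ i j → i ≢ j → (u i ≢ u j) × (w i ≢ w j)) ×
  (∀ i j → i ≢ j → ∀ x y →
     (x ≡ u i [1] ⊎ x ≡ w i [2]) → (y ≡ u j [1] ⊎ y ≡ w j [2]) → ¬ Adj* G x y)

Inπ₀ : ∀ {n q} → LinOrder (V* n) → (Fin q → Fin n) → Fin (V* n) → Set
Inπ₀ π u x = ∃[ i ] x ≤[ π ] (u i [1])

InU1 : ∀ {n q} → (Fin q → Fin n) → Fin (V* n) → Set
InU1 u x = ∃[ i ] x ≡ u i [1]

Inℱ : ∀ {n q} → LinOrder (V* n) → (Fin q → Fin n) → Asg (V* n) → Set
Inℱ π u g =
  (∀ x → Inπ₀ π u x ⇔ InDom g x) ×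
  (∃[ i ] lookup g (u i [1]) ≡ just false) ×
  (∃[ i ] ∃[ j ] u i [1] ≢ u j [1] × lookup g (u i [1]) ≡ just true × lookup g (u j [1]) ≡ just true) ×
  (∀ x → Inπ₀ π u x → ¬ InU1 u x → lookup g x ≡ just true)

W2I : ∀ {n q} → (Fin q → Fin n) → (Fin q → Fin n) → Asg (V* n) → Fin (V* n) → Set
W2I u w g x = ∃[ j ] lookup g (u j [1]) ≡ just true × x ≡ w j [2]

{-# OPTIONS --safe #-}
module Submission where

-- Since B represents ψ(G), the elements of 𝒮(B)|_g are the b ∖ g for the models b of
-- ψ(G) extending g.  For j ∈ I(g), setting every variable outside π₀ to 1 except
-- w_j[2] gives such a model: w_j[2] satisfies ⋁_v ¬v[2], and in an edge clause
-- (v[1] ∨ w_j[2]) the literal v[1] is not 0 in g, as the 0s of g lie on U[1] and M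
-- is induced.  If 𝒮(B)|_g = ℋ₁ × ℋ₂ with w_j[2] and w_k[2] on different sides, the
-- ℋ₁-part of the model for k and the ℋ₂-part of the model for j combine into a model
-- extending g that is 1 on all of V[2] (g is 1 on V[2] ∩ π₀), violating ⋁_v ¬v[2].

open import Defs hiding (sym)
open import Data.Nat using (ℕ)
open import Data.Nat.Properties using (<⇒≱)
open import Data.Fin using (Fin; splitAt)
open import Data.Fin.Properties using (_≟_; splitAt-↑ˡ; splitAt-↑ʳ; any?)
open import Data.Bool using (Bool; true; false; not; if_then_else_)
open import Data.Maybe using (just; nothing; maybe)
open import Data.Vec using (Vec; lookup; tabulate)
open import Data.Vec.Properties using (lookup∘tabulate; lookup-zipWith; tabulate∘lookup; tabulate-cong)
open import Data.List using ([]; _∷_; allFin)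
open import Data.List.Membership.Propositional using (_∈_; lose)
open import Data.List.Membership.Propositional.Properties using (∈-allFin)
import Data.List.Membership.DecPropositional as DecMembership
open import Data.List.Relation.Unary.All using (All; []; _∷_; universal)
open import Data.List.Relation.Unary.All.Properties using (concat⁺; map⁺; ++⁺; ++⁻ʳ)
open import Data.List.Relation.Unary.Any using (here; there; satisfied)
import Data.List.Relation.Unary.Any.Properties as Any
open import Data.Product using (∃-syntax; _×_; _,_; proj₁; proj₂)
open import Data.Sum using (_⊎_; inj₁; inj₂; [_,_]′)
open import Function using (_∘_; _⇔_; mk⇔; Equivalence)
open import Relation.Nullary using (¬_; Dec; yes; no; does; contradiction)
open import Relation.Nullary.Decidable using (dec-true; dec-false)
open import Relation.Binary.PropositionalEquality using (_≡_; _≢_; refl; sym; trans; cong; subst; module ≡-Reasoning)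

open Equivalence using (to; from)

private variable
  N : ℕ

lookup-extensionality : ∀ {A : Set} {m} (xs ys : Vec A m) →
                        (∀ i → lookup xs i ≡ lookup ys i) → xs ≡ ys
lookup-extensionality xs ys eq =
  trans (sym (tabulate∘lookup xs)) (trans (tabulate-cong eq) (tabulate∘lookup ys))

inDom? : (a : Asg N) (x : Fin N) → Dec (InDom a x)
inDom? a x with lookup a x
... | just v  = yes (v , refl)
... | nothing = no λ { (_ , ()) }

¬InDom⇒nothing : ∀ (a : Asg N) x → ¬ InDom a x → lookup a x ≡ nothing
¬InDom⇒nothing a x x∉a with lookup a x
... | just v  = contradiction (v , refl) x∉a
... | nothing = refl

lookup-∪ : ∀ (a b : Asg N) x → lookup (a ∪ b) x ≡ maybe just (lookup b x) (lookup a x)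
lookup-∪ a b x = lookup-zipWith (λ p q → maybe just q p) x a b

⊆ₐ-∪ˡ : ∀ (a b : Asg N) → a ⊆ₐ (a ∪ b)
⊆ₐ-∪ˡ a b x _ ax = trans (lookup-∪ a b x) (cong (maybe just (lookup b x)) ax)

lookup-∪ʳ : ∀ (a b : Asg N) x → lookup a x ≡ nothing → lookup (a ∪ b) x ≡ lookup b x
lookup-∪ʳ a b x ax = trans (lookup-∪ a b x) (cong (maybe just (lookup b x)) ax)

lookup-∖ : ∀ (b g : Asg N) x → lookup g x ≡ nothing → lookup (b ∖ g) x ≡ lookup b x
lookup-∖ b g x gx =
  trans (lookup-zipWith (λ p q → maybe (λ _ → nothing) p q) x b g)
        (cong (maybe (λ _ → nothing) (lookup b x)) gx)

restrict-covering : ∀ (a : Asg N) {X} → (∀ x → x ∈ X) → restrict a X ≡ a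
restrict-covering {N} a {X} X-covers = lookup-extensionality _ _ λ x →
  trans (lookup∘tabulate _ x)
        (cong (λ d → if d then lookup a x else nothing) (dec-true (x ∈? X) (X-covers x)))
  where open DecMembership (_≟_ {N}) using (_∈?_)

valuation : (Fin N → Bool) → Asg N
valuation f = tabulate (just ∘ f)

module _ (g : Asg N) (f : Fin N → Bool) where

  completion-outside : ∀ x → lookup g x ≡ nothing → lookup (g ∪ valuation f) x ≡ just (f x)
  completion-outside x gx = trans (lookup-∪ʳ g (valuation f) x gx) (lookup∘tabulate (just ∘ f) x)

  completion-total : Total (g ∪ valuation f)
  completion-total x with lookup g x in gx
  ... | just v  = v , ⊆ₐ-∪ˡ g (valuation f) x v gx
  ... | nothing = f x , completion-outside x gx

  completion-true : ∀ x → lookup g x ≢ just false → f x ≡ true →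
                    lookup (g ∪ valuation f) x ≡ just true
  completion-true x g≢false fx with lookup g x in gx
  ... | just true  = ⊆ₐ-∪ˡ g (valuation f) x true gx
  ... | just false = contradiction refl g≢false
  ... | nothing    = trans (completion-outside x gx) (cong just fx)

trueExcept : Fin N → Fin N → Bool
trueExcept y x = not (does (x ≟ y))

trueExcept-self : ∀ (y : Fin N) → trueExcept y y ≡ false
trueExcept-self y = cong not (dec-true (y ≟ y) refl)

trueExcept-≢ : ∀ {x y : Fin N} → x ≢ y → trueExcept y x ≡ true
trueExcept-≢ {x = x} {y} x≢y = cong not (dec-false (x ≟ y) x≢y)

uniform-outside : ∀ {D ℋ} {a : Asg N} {x} → UniformOn D ℋ → ℋ a → ¬ D x → lookup a x ≡ nothing
uniform-outside {a = a} {x} uniform ℋa ¬Dx = ¬InDom⇒nothing a x (¬Dx ∘ from (uniform a ℋa x))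

TrueOn : (Fin N → Set) → Asg N → Set
TrueOn D h = ∀ x → D x → lookup h x ≡ just true

-- The ℋ₁-part of the witness for y₂ and the ℋ₂-part of the witness for y₁
-- combine into an element of ℋ = ℋ₁ × ℋ₂ with no exception left.
breaks⇒trueOn : ∀ {D : Fin N → Set} {ℋ Y} → Breaks D ℋ Y →
                (∀ y → Y y → ∃[ h ] ℋ h × TrueOn (λ x → D x × x ≢ y) h) →
                ∃[ h ] ℋ h × TrueOn D h
breaks⇒trueOn (_ , D₁ , D₂ , ℋ₁ , ℋ₂ , uniform₁ , _ , _ , _ , D⇔D₁⊎D₂ , disjoint , ℋ⇔ℋ₁×ℋ₂ ,
               (y₁ , Yy₁ , D₁y₁) , (y₂ , Yy₂ , D₂y₂)) trueExceptAt
  with trueExceptAt y₁ Yy₁ | trueExceptAt y₂ Yy₂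
... | h₁ , ℋh₁ , h₁-true | h₂ , ℋh₂ , h₂-true
  with to (ℋ⇔ℋ₁×ℋ₂ h₁) ℋh₁ | to (ℋ⇔ℋ₁×ℋ₂ h₂) ℋh₂
... | a₁ , a₂ , ℋ₁a₁ , ℋ₂a₂ , refl | b₁ , b₂ , ℋ₁b₁ , _ , refl =
  b₁ ∪ a₂ , from (ℋ⇔ℋ₁×ℋ₂ (b₁ ∪ a₂)) (b₁ , a₂ , ℋ₁b₁ , ℋ₂a₂ , refl) , mixed-true
  where
  mixed-true : TrueOn _ (b₁ ∪ a₂)
  mixed-true x Dx with to (D⇔D₁⊎D₂ x) Dx
  ... | inj₁ D₁x =
    let v , b₁x = to (uniform₁ b₁ ℋ₁b₁ x) D₁x
    in trans (⊆ₐ-∪ˡ b₁ a₂ x v b₁x)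
             (trans (sym (⊆ₐ-∪ˡ b₁ b₂ x v b₁x)) (h₂-true x (Dx , λ { refl → disjoint x (D₁x , D₂y₂) })))
  ... | inj₂ D₂x =
    let ¬D₁x = λ D₁x → disjoint x (D₁x , D₂x)
    in trans (lookup-∪ʳ b₁ a₂ x (uniform-outside uniform₁ ℋ₁b₁ ¬D₁x))
             (trans (sym (lookup-∪ʳ a₁ a₂ x (uniform-outside uniform₁ ℋ₁a₁ ¬D₁x)))
                    (h₁-true x (Dx , λ { refl → disjoint x (D₁y₁ , D₂x) })))

𝒮∣-represented : ∀ {B : BDD N} {φ} → Represents B φ → ∀ g h →
                 𝒮∣ B g h ⇔ (∃[ b ] Satisfies b φ × g ⊆ₐ b × h ≡ b ∖ g)
𝒮∣-represented {B = B} (covers , 𝒮⇔sat) g h = mk⇔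
  (λ (b , 𝒮b , g⊆b , h≡) →
     b , to (𝒮⇔sat b) 𝒮b , subst (_⊆ₐ b) g-restricted g⊆b , trans h≡ (cong (b ∖_) g-restricted))
  (λ (b , sat , g⊆b , h≡) →
     b , from (𝒮⇔sat b) sat , subst (_⊆ₐ b) (sym g-restricted) g⊆b ,
     trans h≡ (cong (b ∖_) (sym g-restricted)))
  where
  g-restricted : restrict g (vars B) ≡ g
  g-restricted = restrict-covering g covers

[1]≢[2] : ∀ {n} (v v′ : Fin n) → v [1] ≢ v′ [2]
[1]≢[2] {n} v v′ eq = contradiction split-eq λ ()
  where
  open ≡-Reasoning
  split-eq : inj₁ v ≡ inj₂ v′
  split-eq = begin
    inj₁ v             ≡⟨ splitAt-↑ˡ n v n ⟨
    splitAt n (v [1])  ≡⟨ cong (splitAt n) eq ⟩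
    splitAt n (v′ [2]) ≡⟨ splitAt-↑ʳ n n v′ ⟩
    inj₂ v′            ∎

module _ {n} (G : Graph n) (b : Asg (V* n)) where

  ψ-satisfied : Total b →
                (∀ v v′ → Edge G v v′ → lookup b (v [1]) ≡ just true ⊎ lookup b (v′ [2]) ≡ just true) →
                (∃[ v ] lookup b (v [1]) ≡ just false) →
                (∃[ v ] lookup b (v [2]) ≡ just false) →
                Satisfies b (ψ G)
  ψ-satisfied total edge (v₁ , b[v₁]) (v₂ , b[v₂]) = total ,
    ++⁺ (concat⁺ (map⁺ (universal (λ v → concat⁺ (map⁺ (universal (edgeClause v) (allFin n))))
                                  (allFin n))))
        (Any.map⁺ (lose (∈-allFin v₁) b[v₁]) ∷ Any.map⁺ (lose (∈-allFin v₂) b[v₂]) ∷ [])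
    where
    edgeClause : ∀ v v′ → All (SatClause b)
      (if adj G v v′ then (pos (v [1]) ∷ pos (v′ [2]) ∷ []) ∷ [] else [])
    edgeClause v v′ with adj G v v′ in e
    ... | true  = [ here , there ∘ here ]′ (edge v v′ e) ∷ []
    ... | false = []

  ψ-satisfied⇒[2]-false : Satisfies b (ψ G) → ∃[ v ] lookup b (v [2]) ≡ just false
  ψ-satisfied⇒[2]-false (_ , clauses) with ++⁻ʳ _ {_ ∷ _ ∷ []} clauses
  ... | _ ∷ V[2]-clause ∷ [] = satisfied (Any.map⁻ V[2]-clause)

module _ {n q} (π : LinOrder (V* n)) (u : Fin q → Fin n) (g : Asg (V* n)) (g∈ℱ : Inℱ π u g) where

  ℱ-true-outside-U[1] : ∀ x → InDom g x → ¬ InU1 u x → lookup g x ≡ just true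
  ℱ-true-outside-U[1] x x∈g x∉U = proj₂ (proj₂ (proj₂ g∈ℱ)) x (from (proj₁ g∈ℱ x) x∈g) x∉U

  ℱ-false⇒U[1] : ∀ x → lookup g x ≡ just false → InU1 u x
  ℱ-false⇒U[1] x gx with any? (λ i → x ≟ u i [1])
  ... | yes x∈U = x∈U
  ... | no  x∉U = contradiction (trans (sym gx) (ℱ-true-outside-U[1] x (false , gx) x∉U)) λ ()

  ℱ-[2]-not-false : ∀ v → lookup g (v [2]) ≢ just false
  ℱ-[2]-not-false v gv with ℱ-false⇒U[1] (v [2]) gv
  ... | i , v≡u = [1]≢[2] (u i) v (sym v≡u)

  module _ (G : Graph n) {w : Fin q → Fin n} (matching : InducedMatching G u w)
           (U<W : ∀ i j → (u i [1]) <[ π ] (w j [2])) where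

    ℱ-W[2]-outside : ∀ j → lookup g (w j [2]) ≡ nothing
    ℱ-W[2]-outside j = ¬InDom⇒nothing g (w j [2]) λ w∈g →
      let i , w≤u = from (proj₁ g∈ℱ _) w∈g in <⇒≱ (U<W i j) w≤u

    ℱ-neighbour-of-W[2] : ∀ j v v′ → lookup g (u j [1]) ≡ just true →
                          Edge G v v′ → v′ [2] ≡ w j [2] → lookup g (v [1]) ≢ just false
    ℱ-neighbour-of-W[2] j v v′ gu e v′≡w gv with ℱ-false⇒U[1] (v [1]) gv
    ... | i , v≡u with i ≟ j
    ...   | yes refl = contradiction (trans (sym gu) (subst (λ y → lookup g y ≡ just false) v≡u gv)) λ ()
    ...   | no  i≢j  = proj₂ (proj₂ matching) i j i≢j _ _ (inj₁ refl) (inj₂ refl)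
                         (v , v′ , e , inj₁ (sym v≡u , sym v′≡w))

    ℱ-completion-satisfies-ψ : ∀ j → lookup g (u j [1]) ≡ just true →
                               Satisfies (g ∪ valuation (trueExcept (w j [2]))) (ψ G)
    ℱ-completion-satisfies-ψ j gu =
      ψ-satisfied G model (completion-total g f) edge
        (let i , gu₀ = proj₁ (proj₂ g∈ℱ) in u i , ⊆ₐ-∪ˡ g (valuation f) (u i [1]) false gu₀)
        (w j , trans (completion-outside g f (w j [2]) (ℱ-W[2]-outside j))
                     (cong just (trueExcept-self (w j [2]))))
      where
      f : Fin (V* n) → Bool
      f = trueExcept (w j [2])
      model : Asg (V* n)
      model = g ∪ valuation f
      edge : ∀ v v′ → Edge G v v′ →
             lookup model (v [1]) ≡ just true ⊎ lookup model (v′ [2]) ≡ just true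
      edge v v′ e with v′ [2] ≟ w j [2]
      ... | no  v′≢w = inj₂ (completion-true g f (v′ [2]) (ℱ-[2]-not-false v′) (trueExcept-≢ v′≢w))
      ... | yes v′≡w = inj₁ (completion-true g f (v [1]) (ℱ-neighbour-of-W[2] j v v′ gu e v′≡w)
                                             (trueExcept-≢ ([1]≢[2] v (w j))))

    module _ {B : BDD (V* n)} (rep : Represents B (ψ G)) where

      𝒮∣-true-except-W[2] : ∀ y → W2I u w g y →
                            ∃[ h ] 𝒮∣ B g h × TrueOn (λ x → dom𝒮∣ B g x × x ≢ y) h
      𝒮∣-true-except-W[2] _ (j , gu , refl) =
        model ∖ g ,
        from (𝒮∣-represented rep g _)
             (model , ℱ-completion-satisfies-ψ j gu , ⊆ₐ-∪ˡ g (valuation f) , refl) ,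
        λ x ((_ , x∉g) , x≢w) →
          trans (lookup-∖ model g x (¬InDom⇒nothing g x x∉g))
                (trans (completion-outside g f x (¬InDom⇒nothing g x x∉g))
                       (cong just (trueExcept-≢ x≢w)))
        where
        f : Fin (V* n) → Bool
        f = trueExcept (w j [2])
        model : Asg (V* n)
        model = g ∪ valuation f

      𝒮∣-not-trueOn : ¬ (∃[ h ] 𝒮∣ B g h × TrueOn (dom𝒮∣ B g) h)
      𝒮∣-not-trueOn (h , h∈𝒮∣ , h-true) with to (𝒮∣-represented rep g h) h∈𝒮∣
      ... | b , sat , g⊆b , refl with ψ-satisfied⇒[2]-false G b sat
      ...   | v , bv with inDom? g (v [2])
      ...     | yes (_ , gv) = ℱ-[2]-not-false v (trans gv (trans (sym (g⊆b _ _ gv)) bv))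
      ...     | no  v∉g      = contradiction
        (trans (sym bv) (trans (sym (lookup-∖ b g (v [2]) (¬InDom⇒nothing g (v [2]) v∉g)))
                               (h-true (v [2]) (proj₁ rep (v [2]) , v∉g))))
        λ ()

lemma8 : ∀ {n q : ℕ} (G : Graph n) → NoIsolated G →
         ∀ (B : BDD (V* n)) (π : LinOrder (V* n)) →
         IsOBDD B π → Represents B (ψ G) →
         ∀ (u w : Fin q → Fin n) →
         InducedMatching G u w →
         (∀ i j → (u i [1]) <[ π ] (w j [2])) →
         ∀ (g : Asg (V* n)) → Inℱ π u g →
         ¬ Breaks (dom𝒮∣ B g) (𝒮∣ B g) (W2I u w g)
-- Only 𝒮(B) enters the argument.
lemma8 G _ B π _ rep u w matching U<W g g∈ℱ breaks =
  𝒮∣-not-trueOn π u g g∈ℱ G matching U<W rep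
    (breaks⇒trueOn breaks (𝒮∣-true-except-W[2] π u g g∈ℱ G matching U<W rep))
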